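{- Let $X'\subseteq X$, $T\subseteq X$, $k\in\mathbb N$ and a colour $c$ be such that $X'$ is $(2k,T,c)$-free, and let $\sigma=(e_0,m_1,e_1,\dots,e_{\ell-1},m_\ell)$ be an $X'$-switching from $c$ to $(m_\ell)_C$ of length $\ell\leq k$. Let $A$ be any set of at most $k$ edges of $M\setminus\{(c)_M\}$ and $B\subseteq X'$ with $|B|\leq k$. Suppose $(\sigma)_X\cap T=\emptyset$, $(\sigma)_X\cap(A)_X=\emptyset$, $(\sigma)_X\cap B=\emptyset$, $T\cap(A)_X=\emptyset$ and $(A)_X\cap B=\emptyset$. Then there is a rainbow matching $\tilde M$ of size $n$ in $G$ which misses colour $(m_\ell)_C$, contains every edge of $A$, and covers no vertex of $(m(\sigma))_X\cup B$.
   Context: Setting: $G$ is a bipartite graph with bipartition classes $X,Y$ which is the union of $n+1$ edge-disjoint matchings $M_1,\dots,M_{n+1}$, called colours (the colour of an edge is the matching containing it). A matching is rainbow if its edges have distinct colours. $M$ is a rainbow matching of size $n$ in $G$, $c^*$ is the colour missing from $M$, $X_0=X\setminus V(M)$. Notation: for an edge $e$, $(e)_C$ is its colour, $(e)_X=e\cap X$, $(e)_Y=e\cap Y$. For $x\in X$ covered by $M$, $(x)_M$ is the edge of $M$ at $x$ and $(x)_C$ its colour; similarly for $y\in Y$. For a colour $c\neq c^*$, $(c)_M$ is the colour-$c$ edge of $M$, $(c)_X=(c)_M\cap X$, $(c)_Y=(c)_M\cap Y$ (undefined for $c^*$). For a set $S$, $(S)_M,(S)_X,(S)_Y,(S)_C$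 are the sets of defined images of its elements. A matching $M'$ "agrees with $M$ on $A$" if $A\subseteq M'$. Switching: for $X'\subseteq X$, a sequence of edges $\sigma=(e_0,m_1,e_1,m_2,\dots,e_{\ell-1},m_\ell)$ is an $X'$-switching if (i) each $m_i\in M$ and each $e_i\notin M$; (ii) $m_i$ and $e_i$ have the same colour $c_i$ (here $c_0$ is the colour of $e_0$, $c_\ell$ that of $m_\ell$); (iii) $e_{i-1}\cap m_i=(m_i)_Y$ for all $i$; (iv) for $i\neq j$, $e_i\cap e_j=\emptyset$, $e_{i-1}\cap m_j=\emptyset$ and $c_i\neq c_j$; (v) $(e_i)_X\in X'$ for all $i$. It is a length-$\ell$ switching from $c_0$ to $c_\ell$. Put $e(\sigma)=\{e_0,\dots,e_{\ell-1}\}$, $m(\sigma)=\{m_1,\dots,m_\ell\}$, $(\sigma)_X=(e(\sigma))_X\cup(m(\sigma))_X$. Free sets: for $X',T\subseteq X$, $k\in\mathbb N$ and colour $c$, $X'$ is $(k,T,c)$-free if $T\cap X'=\emptyset$, $c\notin(X'\cup T)_C$, and for every set $A$ of at most $k$ edges of $M\setminus((T)_M\cup\{(c)_M\})$ and every $B\subseteq X'$ with $|B|\le k$ and $(A)_X\cap B=\emptyset$, there is a rainbow matching $M'$ of size $n$ with $A\subseteq M'$, covering no vertex of $B$, and missing colour $c$. -}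

module Defs where

open import Data.Nat using (ℕ; suc; _≤_)
open import Data.Fin using (Fin; zero; suc; inject₁; fromℕ)
open import Data.Fin.Subset using (Subset; _∈_; _∉_; _⊆_; ∣_∣)
open import Data.List using (List; length)
open import Data.List.Membership.Propositional
  renaming (_∈_ to _∈ₗ_; _∉_ to _∉ₗ_)
open import Data.List.Relation.Unary.AllPairs using (AllPairs)
open import Data.List.Relation.Unary.Unique.Propositional using (Unique)
open import Data.Product using (Σ; _×_; _,_)
open import Data.Sum using (_⊎_)
open import Data.Empty using (⊥)
open import Relation.Binary.PropositionalEquality using (_≡_; _≢_)

-- Vertex classes X = Fin p, Y = Fin q; colours = Fin (suc n) (the n+1 matchings).
-- An edge xy of colour c (i.e. lying in the matching M_c) is the triple (x , y , c).
record Edge (p q n : ℕ) : Set where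
  constructor edge
  field
    ex : Fin p
    ey : Fin q
    ec : Fin (suc n)
open Edge public

Graph : ℕ → ℕ → ℕ → Set₁
Graph p q n = Edge p q n → Set

IsUnionOfMatchings : ∀ {p q n} → Graph p q n → Set
IsUnionOfMatchings {p} {q} {n} G =
    (∀ (x : Fin p) (y : Fin q) (c c' : Fin (suc n)) →
       G (edge x y c) → G (edge x y c') → c ≡ c')
  × (∀ e f → G e → G f → ec e ≡ ec f → ex e ≡ ex f → e ≡ f)
  × (∀ e f → G e → G f → ec e ≡ ec f → ey e ≡ ey f → e ≡ f)

Disjoint : ∀ {p q n} → Edge p q n → Edge p q n → Set
Disjoint e f = ex e ≢ ex f × ey e ≢ ey f

IsRainbowMatching : ∀ {p q n} → Graph p q n → List (Edge p q n) → Set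
IsRainbowMatching G M' =
  (∀ e → e ∈ₗ M' → G e) × AllPairs (λ e f → Disjoint e f × ec e ≢ ec f) M'

IsRainbowMatchingOfSize : ∀ {p q n} → Graph p q n → ℕ → List (Edge p q n) → Set
IsRainbowMatchingOfSize G s M' = IsRainbowMatching G M' × length M' ≡ s

Misses : ∀ {p q n} → List (Edge p q n) → Fin (suc n) → Set
Misses M' c = ∀ e → e ∈ₗ M' → ec e ≢ c

Contains : ∀ {p q n} → List (Edge p q n) → List (Edge p q n) → Set
Contains M' A = ∀ e → e ∈ₗ A → e ∈ₗ M'

CoversNone : ∀ {p q n} → List (Edge p q n) → (Fin p → Set) → Set
CoversNone M' S = ∀ e → e ∈ₗ M' → S (ex e) → ⊥

-- e ≠ (c)_M  (vacuous if M has no edge of colour c, i.e. c = c*)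
NotColourEdge : ∀ {p q n} → List (Edge p q n) → Fin (suc n) → Edge p q n → Set
NotColourEdge M c e = ∀ f → f ∈ₗ M → ec f ≡ c → e ≢ f

InAX : ∀ {p q n} → List (Edge p q n) → Fin p → Set
InAX A x = Σ _ (λ e → e ∈ₗ A × ex e ≡ x)

Free : ∀ {p q n} → Graph p q n → List (Edge p q n) →
       Subset p → Subset p → ℕ → Fin (suc n) → Set
Free {p} {q} {n} G M X' T k c =
    (∀ x → x ∈ T → x ∉ X')
  × (∀ e → e ∈ₗ M → (ex e ∈ X' ⊎ ex e ∈ T) → ec e ≢ c)
  × (∀ (A : List (Edge p q n)) (B : Subset p) →
       Unique A → length A ≤ k →
       (∀ e → e ∈ₗ A → e ∈ₗ M × ex e ∉ T × NotColourEdge M c e) →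
       B ⊆ X' → ∣ B ∣ ≤ k →
       (∀ e → e ∈ₗ A → ex e ∉ B) →
       Σ (List (Edge p q n)) (λ M' →
         IsRainbowMatchingOfSize G n M' × Contains M' A ×
         CoversNone M' (_∈ B) × Misses M' c))

-- An X'-switching σ = (e_0, m_1, e_1, …, e_{ℓ-1}, m_ℓ) of length ℓ.
-- es i = e_i and ms i = m_{i+1} for i : Fin ℓ; cs j = c_j for j = 0..ℓ.
record Switching {p q n} (G : Graph p q n) (M : List (Edge p q n))
                 (X' : Subset p) (ℓ : ℕ) : Set where
  field
    es : Fin ℓ → Edge p q n
    ms : Fin ℓ → Edge p q n
    cs : Fin (suc ℓ) → Fin (suc n)
    es-G   : ∀ i → G (es i)
    ms-M   : ∀ i → ms i ∈ₗ M
    es-M   : ∀ i → es i ∉ₗ M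
    es-col : ∀ i → ec (es i) ≡ cs (inject₁ i)
    ms-col : ∀ i → ec (ms i) ≡ cs (suc i)
    link   : ∀ i → ey (es i) ≡ ey (ms i) × ex (es i) ≢ ex (ms i)
    es-disj    : ∀ i j → i ≢ j → Disjoint (es i) (es j)
    es-ms-disj : ∀ i j → i ≢ j → Disjoint (es i) (ms j)
    cs-inj     : ∀ i j → i ≢ j → cs i ≢ cs j
    es-X'  : ∀ i → ex (es i) ∈ X'

module _ {p q n} {G : Graph p q n} {M : List (Edge p q n)} {X' : Subset p} {ℓ : ℕ}
         (σ : Switching G M X' ℓ) where
  open Switching σ
  InmσX : Fin p → Set
  InmσX x = Σ (Fin ℓ) (λ i → ex (ms i) ≡ x)
  InσX : Fin p → Set
  InσX x = Σ (Fin ℓ) (λ i → ex (es i) ≡ x) ⊎ InmσX x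
  lastColour : Fin (suc n)
  lastColour = cs (fromℕ ℓ)

module Submission where

-- Enlarge the request (A, B) to
--     A⁺ = A ∪ m(σ)          and          B⁺ = B ∪ (e(σ))_X ,
-- both of size at most 2k since ℓ ≤ k.  Freeness of X' yields a rainbow
-- matching M' of size n that contains A⁺, covers no vertex of B⁺ and misses
-- c = c₀.  Then switch along σ: replace every m_i by e_i.  Since M' avoids
-- (e(σ))_X, and the colour c_i of e_i is either c₀ (missing from M') or the
-- colour of m_i (removed), the result M̃ is again a rainbow matching of size
-- n; it now misses c_ℓ, still contains A (which is disjoint from m(σ)), and
-- covers neither (m(σ))_X nor B.

open import Defs
open import Data.Nat using (ℕ; zero; suc; _≤_; _*_; _+_; z≤n; s≤s)
open import Data.Nat.Properties using (≤-trans; ≤-reflexive; +-mono-≤; +-monoʳ-≤; +-suc; +-identityʳ; n≤1+n)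
open import Data.Fin using (Fin; zero; suc; inject₁; fromℕ; _≟_)
open import Data.Fin.Properties using (any?; suc-injective; inject₁-injective; fromℕ≢inject₁)
open import Data.Fin.Subset using (Subset; _∈_; _∉_; _⊆_; ∣_∣; ⁅_⁆; _∪_; inside; outside) renaming (⊥ to ∅)
open import Data.Fin.Subset.Properties using (x∈⁅x⁆; x∈⁅y⁆⇒x≡y; ∣⁅x⁆∣≡1; x∈p∪q⁻; x∈p∪q⁺; ∉⊥; ∣⊥∣≡0)
open import Data.Vec using (_∷_; [])
open import Data.List using (List; []; _∷_; length; _++_; map; tabulate)
open import Data.List.Properties using (length-++; length-tabulate; length-map)
open import Data.List.Membership.Propositional using () renaming (_∈_ to _∈ₗ_)
open import Data.List.Membership.Propositional.Properties using (∈-map⁺; ∈-map⁻; ∈-++⁺ˡ; ∈-++⁺ʳ; ∈-++⁻; ∈-tabulate⁺; ∈-tabulate⁻)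
open import Data.List.Relation.Unary.Any using (here; there)
import Data.List.Relation.Unary.All as All
import Data.List.Relation.Unary.All.Properties as All
open import Data.List.Relation.Unary.AllPairs using (AllPairs; []; _∷_)
open import Data.List.Relation.Unary.Unique.Propositional using (Unique)
import Data.List.Relation.Unary.Unique.Propositional.Properties as Unique
open import Data.Product using (Σ; _×_; _,_; proj₁; proj₂)
open import Data.Sum using (_⊎_; inj₁; inj₂; [_,_]′)
open import Data.Empty using (⊥; ⊥-elim)
open import Relation.Nullary using (¬_; Dec; yes; no)
open import Relation.Binary.PropositionalEquality using (_≡_; _≢_; refl; sym; trans; cong; subst)
open import Function using (_∘_)

∣p∪q∣≤∣p∣+∣q∣ : ∀ {m} (p q : Subset m) → ∣ p ∪ q ∣ ≤ ∣ p ∣ + ∣ q ∣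
∣p∪q∣≤∣p∣+∣q∣ []            []            = z≤n
∣p∪q∣≤∣p∣+∣q∣ (outside ∷ p) (outside ∷ q) = ∣p∪q∣≤∣p∣+∣q∣ p q
∣p∪q∣≤∣p∣+∣q∣ (inside ∷ p)  (outside ∷ q) = s≤s (∣p∪q∣≤∣p∣+∣q∣ p q)
∣p∪q∣≤∣p∣+∣q∣ (outside ∷ p) (inside ∷ q)  =
  ≤-trans (s≤s (∣p∪q∣≤∣p∣+∣q∣ p q)) (≤-reflexive (sym (+-suc ∣ p ∣ ∣ q ∣)))
∣p∪q∣≤∣p∣+∣q∣ (inside ∷ p)  (inside ∷ q)  =
  s≤s (≤-trans (∣p∪q∣≤∣p∣+∣q∣ p q) (+-monoʳ-≤ ∣ p ∣ (n≤1+n ∣ q ∣)))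

image : ∀ {p} m → (Fin m → Fin p) → Subset p
image zero    g = ∅
image (suc m) g = ⁅ g zero ⁆ ∪ image m (g ∘ suc)

∈-image⁺ : ∀ {p} m (g : Fin m → Fin p) i → g i ∈ image m g
∈-image⁺ (suc m) g zero    = x∈p∪q⁺ (inj₁ (x∈⁅x⁆ (g zero)))
∈-image⁺ (suc m) g (suc i) = x∈p∪q⁺ (inj₂ (∈-image⁺ m (g ∘ suc) i))

∈-image⁻ : ∀ {p} m (g : Fin m → Fin p) {x} → x ∈ image m g → Σ (Fin m) (λ i → g i ≡ x)
∈-image⁻ zero    g x∈ = ⊥-elim (∉⊥ x∈)
∈-image⁻ (suc m) g x∈ with x∈p∪q⁻ ⁅ g zero ⁆ (image m (g ∘ suc)) x∈
... | inj₁ x∈⁅g0⁆ = zero , sym (x∈⁅y⁆⇒x≡y (g zero) x∈⁅g0⁆)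
... | inj₂ x∈rest with ∈-image⁻ m (g ∘ suc) x∈rest
...   | i , gi≡x = suc i , gi≡x

∣image∣≤ : ∀ {p} m (g : Fin m → Fin p) → ∣ image m g ∣ ≤ m
∣image∣≤ {p} zero g = ≤-reflexive (∣⊥∣≡0 p)
∣image∣≤ (suc m) g =
  ≤-trans (∣p∪q∣≤∣p∣+∣q∣ ⁅ g zero ⁆ (image m (g ∘ suc)))
          (+-mono-≤ (≤-reflexive (∣⁅x⁆∣≡1 (g zero))) (∣image∣≤ m (g ∘ suc)))

+-≤-2* : ∀ {a b k} → a ≤ k → b ≤ k → a + b ≤ 2 * k
+-≤-2* {k = k} a≤k b≤k =
  ≤-trans (+-mono-≤ a≤k b≤k) (≤-reflexive (cong (k +_) (sym (+-identityʳ k))))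

AllPairs-lookup : ∀ {A : Set} {R : A → A → Set} → (∀ {x y} → R x y → R y x) →
  ∀ {xs} → AllPairs R xs → ∀ {x y} → x ∈ₗ xs → y ∈ₗ xs → x ≢ y → R x y
AllPairs-lookup sym-R (_  ∷ _)  (here refl) (here refl) x≢y = ⊥-elim (x≢y refl)
AllPairs-lookup sym-R (rx ∷ _)  (here refl) (there y∈)  _   = All.lookup rx y∈
AllPairs-lookup sym-R (rx ∷ _)  (there x∈)  (here refl) _   = sym-R (All.lookup rx x∈)
AllPairs-lookup sym-R (_  ∷ rs) (there x∈)  (there y∈)  x≢y = AllPairs-lookup sym-R rs x∈ y∈ x≢y

AllPairs-map∈ : ∀ {A B : Set} {R : A → A → Set} {S : B → B → Set} {f : A → B} {xs} →
  AllPairs R xs → (∀ {x y} → x ∈ₗ xs → y ∈ₗ xs → R x y → S (f x) (f y)) →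
  AllPairs S (map f xs)
AllPairs-map∈ []       _    = []
AllPairs-map∈ (rx ∷ rs) pres =
  All.map⁺ (All.tabulate (λ y∈ → pres (here refl) (there y∈) (All.lookup rx y∈)))
  ∷ AllPairs-map∈ rs (λ x∈ y∈ → pres (there x∈) (there y∈))

_≟ₑ_ : ∀ {p q n} (e f : Edge p q n) → Dec (e ≡ f)
edge x y c ≟ₑ edge x' y' c' with x ≟ x' | y ≟ y' | c ≟ c'
... | yes refl | yes refl | yes refl = yes refl
... | no x≢x'  | _        | _        = no λ { refl → x≢x' refl }
... | yes _    | no y≢y'  | _        = no λ { refl → y≢y' refl }
... | yes _    | yes _    | no c≢c'  = no λ { refl → c≢c' refl }

Compatible : ∀ {p q n} → Edge p q n → Edge p q n → Set
Compatible e f = Disjoint e f × ec e ≢ ec f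

Compatible-sym : ∀ {p q n} {e f : Edge p q n} → Compatible e f → Compatible f e
Compatible-sym ((x≢ , y≢) , c≢) = ((x≢ ∘ sym) , (y≢ ∘ sym)) , (c≢ ∘ sym)

module Switch {p q n} {G : Graph p q n} {M : List (Edge p q n)} {X' : Subset p} {ℓ : ℕ}
              (σ : Switching G M X' (suc ℓ)) where
  open Switching σ

  -- The edges m_i are distinct, as their colours c_{i+1} are.
  ms-injective : ∀ {i j} → ms i ≡ ms j → i ≡ j
  ms-injective {i} {j} mi≡mj with i ≟ j
  ... | yes i≡j = i≡j
  ... | no  i≢j = ⊥-elim (cs-inj (suc i) (suc j) (i≢j ∘ suc-injective)
                    (trans (sym (ms-col i)) (trans (cong ec mi≡mj) (ms-col j))))

  es≢ms-X : ∀ i j → ex (es i) ≢ ex (ms j)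
  es≢ms-X i j with i ≟ j
  ... | yes refl = proj₂ (link i)
  ... | no  i≢j  = proj₁ (es-ms-disj i j i≢j)

  InEσX : Fin p → Set
  InEσX x = Σ (Fin (suc ℓ)) (λ i → ex (es i) ≡ x)

  classify : ∀ e → Σ (Fin (suc ℓ)) (λ i → e ≡ ms i) ⊎ (∀ i → e ≢ ms i)
  classify e with any? (λ i → e ≟ₑ ms i)
  ... | yes (i , e≡mi) = inj₁ (i , e≡mi)
  ... | no  ¬∃         = inj₂ (λ i e≡mi → ¬∃ (i , e≡mi))

  replace : Edge p q n → Edge p q n
  replace e with classify e
  ... | inj₁ (i , _) = es i
  ... | inj₂ _       = e

  replace-other : ∀ e → (∀ i → e ≢ ms i) → replace e ≡ e
  replace-other e ≢ms with classify e
  ... | inj₁ (i , e≡mi) = ⊥-elim (≢ms i e≡mi)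
  ... | inj₂ _          = refl

  module On (M' : List (Edge p q n)) (rainbow : IsRainbowMatching G M')
           (ms∈M' : ∀ i → ms i ∈ₗ M') (avoids : CoversNone M' InEσX)
           (misses : Misses M' (cs zero)) where

    switched : List (Edge p q n)
    switched = map replace M'

    ∈-switched⁻ : ∀ {e} → e ∈ₗ switched →
      Σ (Fin (suc ℓ)) (λ i → e ≡ es i) ⊎ (e ∈ₗ M' × ∀ i → e ≢ ms i)
    ∈-switched⁻ e∈ with ∈-map⁻ replace e∈
    ... | x , x∈ , refl with classify x
    ...   | inj₁ (i , refl) = inj₁ (i , refl)
    ...   | inj₂ ≢ms        = inj₂ (x∈ , ≢ms)

    ∈-switched⁺ : ∀ {e} → e ∈ₗ M' → (∀ i → e ≢ ms i) → e ∈ₗ switched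
    ∈-switched⁺ {e} e∈ ≢ms = subst (_∈ₗ switched) (replace-other e ≢ms) (∈-map⁺ replace e∈)

    other≢ms-colour : ∀ {e} → e ∈ₗ M' → (∀ i → e ≢ ms i) → ∀ j → ec e ≢ ec (ms j)
    other≢ms-colour e∈ ≢ms j = proj₂ (AllPairs-lookup Compatible-sym (proj₂ rainbow) e∈ (ms∈M' j) (≢ms j))

    es≢other-colour : ∀ {e} → e ∈ₗ M' → (∀ i → e ≢ ms i) → ∀ i → ec (es i) ≢ ec e
    es≢other-colour e∈ ≢ms zero    c≡ = misses _ e∈ (trans (sym c≡) (es-col zero))
    es≢other-colour e∈ ≢ms (suc i) c≡ = other≢ms-colour e∈ ≢ms (inject₁ i)
      (trans (sym c≡) (trans (es-col (suc i)) (sym (ms-col (inject₁ i)))))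

    es-compatible-other : ∀ i {e} → e ∈ₗ M' → (∀ j → e ≢ ms j) →
      Compatible (ms i) e → Compatible (es i) e
    es-compatible-other i {e} e∈ ≢ms ((_ , y≢) , _) =
      ((λ x≡ → avoids e e∈ (i , x≡)) , (λ y≡ → y≢ (trans (sym (proj₁ (link i))) y≡))) ,
      es≢other-colour e∈ ≢ms i

    es-compatible : ∀ i j → Compatible (ms i) (ms j) → Compatible (es i) (es j)
    es-compatible i j ((x≢ , _) , _) with i ≟ j
    ... | yes refl = ⊥-elim (x≢ refl)
    ... | no  i≢j  = es-disj i j i≢j ,
          λ c≡ → cs-inj (inject₁ i) (inject₁ j) (i≢j ∘ inject₁-injective)
                   (trans (sym (es-col i)) (trans c≡ (es-col j)))

    replace-compatible : ∀ {x y} → x ∈ₗ M' → y ∈ₗ M' →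
      Compatible x y → Compatible (replace x) (replace y)
    replace-compatible {x} {y} x∈ y∈ xy with classify x | classify y
    ... | inj₁ (i , refl) | inj₁ (j , refl) = es-compatible i j xy
    ... | inj₁ (i , refl) | inj₂ ≢ms        = es-compatible-other i y∈ ≢ms xy
    ... | inj₂ ≢ms        | inj₁ (j , refl) =
      Compatible-sym (es-compatible-other j x∈ ≢ms (Compatible-sym xy))
    ... | inj₂ _          | inj₂ _          = xy

    switched-rainbow : IsRainbowMatchingOfSize G (length M') switched
    switched-rainbow = (inG , AllPairs-map∈ (proj₂ rainbow) replace-compatible) , length-map replace M'
      where
      inG : ∀ e → e ∈ₗ switched → G e
      inG e e∈ with ∈-switched⁻ e∈
      ... | inj₁ (i , refl)  = es-G i
      ... | inj₂ (e∈M' , _) = proj₁ rainbow e e∈M'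

    -- c_ℓ was carried by m_ℓ, which is gone, and is not the colour of any e_i.
    switched-misses : Misses switched (lastColour σ)
    switched-misses e e∈ with ∈-switched⁻ e∈
    ... | inj₁ (i , refl) = λ c≡ → cs-inj (inject₁ i) (fromℕ (suc ℓ)) (fromℕ≢inject₁ ∘ sym)
                              (trans (sym (es-col i)) c≡)
    ... | inj₂ (e∈M' , ≢ms) = λ c≡ → other≢ms-colour e∈M' ≢ms (fromℕ ℓ)
                                (trans c≡ (sym (ms-col (fromℕ ℓ))))

    -- (m(σ))_X becomes uncovered: e_i avoids it, untouched edges are disjoint
    -- from the m_j.
    switched-avoids-mσ : CoversNone switched (InmσX σ)
    switched-avoids-mσ e e∈ (j , mj≡) with ∈-switched⁻ e∈
    ... | inj₁ (i , refl) = es≢ms-X i j (sym mj≡)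
    ... | inj₂ (e∈M' , ≢ms) =
      proj₁ (proj₁ (AllPairs-lookup Compatible-sym (proj₂ rainbow) e∈M' (ms∈M' j) (≢ms j))) (sym mj≡)

    switched-avoids : (S : Fin p → Set) → CoversNone M' S → (∀ i → ¬ S (ex (es i))) →
      CoversNone switched S
    switched-avoids S M'∩S es∉S e e∈ with ∈-switched⁻ e∈
    ... | inj₁ (i , refl)    = es∉S i
    ... | inj₂ (e∈M' , _)    = M'∩S e e∈M'

module Request {p q n} {G : Graph p q n} {M : List (Edge p q n)} {X' T : Subset p}
               {k ℓ : ℕ} {c : Fin (suc n)}
               (σ : Switching G M X' (suc ℓ)) (cs₀≡c : Switching.cs σ zero ≡ c)
               (A : List (Edge p q n)) (B : Subset p)
               (σ∩T : ∀ x → InσX σ x → x ∉ T)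
               (σ∩A : ∀ x → InσX σ x → InAX A x → ⊥)
               (σ∩B : ∀ x → InσX σ x → x ∉ B) where
  open Switching σ
  open Switch σ using (ms-injective; es≢ms-X; InEσX)

  A⁺ : List (Edge p q n)
  A⁺ = A ++ tabulate ms

  EσX : Subset p
  EσX = image (suc ℓ) (ex ∘ es)

  B⁺ : Subset p
  B⁺ = B ∪ EσX

  A∩mσ : ∀ {e} → e ∈ₗ A → ∀ i → e ≢ ms i
  A∩mσ e∈A i refl = σ∩A (ex (ms i)) (inj₂ (i , refl)) (ms i , e∈A , refl)

  A⁺-unique : Unique A → Unique A⁺
  A⁺-unique uA = Unique.++⁺ uA (Unique.tabulate⁺ ms-injective) disjoint
    where
    disjoint : ∀ {e} → ¬ (e ∈ₗ A × e ∈ₗ tabulate ms)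
    disjoint (e∈A , e∈mσ) with ∈-tabulate⁻ {f = ms} e∈mσ
    ... | i , e≡mi = A∩mσ e∈A i e≡mi

  |A⁺|≤2k : length A ≤ k → suc ℓ ≤ k → length A⁺ ≤ 2 * k
  |A⁺|≤2k |A|≤k ℓ≤k =
    ≤-trans (≤-reflexive (trans (length-++ A) (cong (length A +_) (length-tabulate ms))))
            (+-≤-2* |A|≤k ℓ≤k)

  -- The edges m_i lie in M, avoid T, and are not (c)_M since c_i ≠ c₀ = c.
  A⁺-admissible : (∀ e → e ∈ₗ A → e ∈ₗ M × NotColourEdge M c e) →
    (∀ x → x ∈ T → InAX A x → ⊥) →
    ∀ e → e ∈ₗ A⁺ → e ∈ₗ M × ex e ∉ T × NotColourEdge M c e
  A⁺-admissible A-ok T∩A e e∈ with ∈-++⁻ A e∈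
  ... | inj₁ e∈A = proj₁ (A-ok e e∈A) , (λ x∈T → T∩A (ex e) x∈T (e , e∈A , refl)) , proj₂ (A-ok e e∈A)
  ... | inj₂ e∈mσ with ∈-tabulate⁻ {f = ms} e∈mσ
  ...   | i , refl = ms-M i , σ∩T (ex (ms i)) (inj₂ (i , refl)) ,
          λ f _ fc≡c mi≡f → cs-inj (suc i) zero (λ ())
            (trans (sym (ms-col i)) (trans (cong ec mi≡f) (trans fc≡c (sym cs₀≡c))))

  B⁺⊆X' : B ⊆ X' → B⁺ ⊆ X'
  B⁺⊆X' B⊆X' x∈ with x∈p∪q⁻ B EσX x∈
  ... | inj₁ x∈B = B⊆X' x∈B
  ... | inj₂ x∈E with ∈-image⁻ (suc ℓ) (ex ∘ es) x∈E
  ...   | i , refl = es-X' i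

  |B⁺|≤2k : ∣ B ∣ ≤ k → suc ℓ ≤ k → ∣ B⁺ ∣ ≤ 2 * k
  |B⁺|≤2k |B|≤k ℓ≤k =
    ≤-trans (∣p∪q∣≤∣p∣+∣q∣ B EσX) (+-≤-2* |B|≤k (≤-trans (∣image∣≤ (suc ℓ) (ex ∘ es)) ℓ≤k))

  A⁺∩B⁺ : (∀ x → InAX A x → x ∉ B) → ∀ e → e ∈ₗ A⁺ → ex e ∉ B⁺
  A⁺∩B⁺ A∩B e e∈ x∈ with ∈-++⁻ A e∈ | x∈p∪q⁻ B EσX x∈
  ... | inj₁ e∈A | inj₁ x∈B = A∩B (ex e) (e , e∈A , refl) x∈B
  ... | inj₁ e∈A | inj₂ x∈E with ∈-image⁻ (suc ℓ) (ex ∘ es) x∈E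
  ...   | i , es≡ = σ∩A (ex e) (inj₁ (i , es≡)) (e , e∈A , refl)
  A⁺∩B⁺ A∩B e e∈ x∈ | inj₂ e∈mσ | x∈B⁺ with ∈-tabulate⁻ {f = ms} e∈mσ
  ... | i , refl with x∈B⁺
  ...   | inj₁ x∈B = σ∩B (ex (ms i)) (inj₂ (i , refl)) x∈B
  ...   | inj₂ x∈E with ∈-image⁻ (suc ℓ) (ex ∘ es) x∈E
  ...     | j , es≡ = es≢ms-X j i es≡

  ms∈ : ∀ {M' : List (Edge p q n)} → Contains M' A⁺ → ∀ i → ms i ∈ₗ M'
  ms∈ A⁺⊆M' i = A⁺⊆M' (ms i) (∈-++⁺ʳ A (∈-tabulate⁺ {f = ms} i))

  avoids-EσX : ∀ {M' : List (Edge p q n)} → CoversNone M' (_∈ B⁺) → CoversNone M' InEσX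
  avoids-EσX M'∩B⁺ e e∈ (i , es≡) =
    M'∩B⁺ e e∈ (x∈p∪q⁺ (inj₂ (subst (_∈ EσX) es≡ (∈-image⁺ (suc ℓ) (ex ∘ es) i))))

  avoids-B : ∀ {M' : List (Edge p q n)} → CoversNone M' (_∈ B⁺) → CoversNone M' (_∈ B)
  avoids-B M'∩B⁺ e e∈ x∈B = M'∩B⁺ e e∈ (x∈p∪q⁺ (inj₁ x∈B))

  misses-c₀ : ∀ {M' : List (Edge p q n)} → Misses M' c → Misses M' (cs zero)
  misses-c₀ {M'} = subst (Misses M') (sym cs₀≡c)

  es∉B : ∀ i → ex (es i) ∉ B
  es∉B i = σ∩B (ex (es i)) (inj₁ (i , refl))

lemma3p3 : ∀ {p q n} (G : Graph p q n) → IsUnionOfMatchings G →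
    (M : List (Edge p q n)) → IsRainbowMatchingOfSize G n M →
    (X' T : Subset p) (k : ℕ) (c : Fin (suc n)) →
    Free G M X' T (2 * k) c →
    (ℓ : ℕ) → 1 ≤ ℓ → ℓ ≤ k →
    (σ : Switching G M X' ℓ) → Switching.cs σ zero ≡ c →
    (A : List (Edge p q n)) → Unique A → length A ≤ k →
    (∀ e → e ∈ₗ A → e ∈ₗ M × NotColourEdge M c e) →
    (B : Subset p) → B ⊆ X' → ∣ B ∣ ≤ k →
    (∀ x → InσX σ x → x ∉ T) →
    (∀ x → InσX σ x → InAX A x → ⊥) →
    (∀ x → InσX σ x → x ∉ B) →
    (∀ x → x ∈ T → InAX A x → ⊥) →
    (∀ x → InAX A x → x ∉ B) →
    Σ (List (Edge p q n)) (λ M~ →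
    IsRainbowMatchingOfSize G n M~ × Misses M~ (lastColour σ) ×
    Contains M~ A × CoversNone M~ (λ x → InmσX σ x ⊎ x ∈ B))
lemma3p3 G _ M _ X' T k c (_ , _ , extend) (suc ℓ) _ ℓ≤k σ cs₀≡c
         A uA |A|≤k A-ok B B⊆X' |B|≤k σ∩T σ∩A σ∩B T∩A A∩B =
  let open Request σ cs₀≡c A B σ∩T σ∩A σ∩B
      (M' , (rainbow , |M'|≡n) , A⁺⊆M' , M'∩B⁺ , M'-misses-c) =
        extend A⁺ B⁺ (A⁺-unique uA) (|A⁺|≤2k |A|≤k ℓ≤k) (A⁺-admissible A-ok T∩A)
               (B⁺⊆X' B⊆X') (|B⁺|≤2k |B|≤k ℓ≤k) (A⁺∩B⁺ A∩B)
      open Switch.On σ M' rainbow (ms∈ A⁺⊆M') (avoids-EσX M'∩B⁺) (misses-c₀ M'-misses-c)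
  in switched ,
     (proj₁ switched-rainbow , trans (proj₂ switched-rainbow) |M'|≡n) ,
     switched-misses ,
     (λ e e∈A → ∈-switched⁺ (A⁺⊆M' e (∈-++⁺ˡ e∈A)) (A∩mσ e∈A)) ,
     λ e e∈ → [ switched-avoids-mσ e e∈ , switched-avoids (_∈ B) (avoids-B M'∩B⁺) es∉B e e∈ ]′
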